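{- Let $r$ be a positive integer, let $G$ be an $r$-BG graph with at least $r+1$ vertices, and let $A_0$ be a percolating set of $G$ (with threshold $r$) with $|A_0|=r$. If $X$ is a cut set of $G$ with $|X|<r$, then there is no cut set $Y$ of $G$ with $|Y|<r$ and $Y\cap X=\emptyset$.
   Context: Bootstrap percolation with threshold $r$ on a finite simple graph $G$: starting from an initially infected set $A_0\subseteq V(G)$, define $A_t=A_{t-1}\cup\{v\in V(G): |N(v)\cap A_{t-1}|\ge r\}$ for $t\ge1$; $A_0$ percolates if eventually every vertex is infected. $G$ is $r$-bootstrap good ($r$-BG) if it contains a set of $r$ vertices which percolates with threshold $r$. A cut set of $G$ is a set $X\subseteq V(G)$ such that $G-X$ is disconnected. -}

module Defs where

open import Data.Nat using (ℕ; zero; suc; _≤ᵇ_)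
open import Data.Bool using (Bool; true; false)
open import Data.Fin using (Fin)
open import Data.Fin.Subset using (Subset; _∈_; _∉_; _∩_; _∪_; ∣_∣)
open import Data.Vec using (tabulate)
open import Data.Product using (∃; ∃-syntax; _×_)
open import Relation.Binary.PropositionalEquality using (_≡_)
open import Relation.Nullary using (¬_)

record Graph (n : ℕ) : Set where
  field
    adj    : Fin n → Fin n → Bool
    sym    : ∀ u v → adj u v ≡ adj v u
    irrefl : ∀ v → adj v v ≡ false
open Graph public

N : ∀ {n} → Graph n → Fin n → Subset n
N G v = tabulate (adj G v)

step : ∀ {n} → ℕ → Graph n → Subset n → Subset n
step r G A = A ∪ tabulate (λ v → r ≤ᵇ ∣ N G v ∩ A ∣)

infected : ∀ {n} → ℕ → Graph n → Subset n → ℕ → Subset n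
infected r G A zero    = A
infected r G A (suc t) = step r G (infected r G A t)

Percolates : ∀ {n} → ℕ → Graph n → Subset n → Set
Percolates r G A = ∃[ t ] (∀ v → v ∈ infected r G A t)

BG : ∀ {n} → ℕ → Graph n → Set
BG r G = ∃[ A ] (∣ A ∣ ≡ r × Percolates r G A)

data Reach {n} (G : Graph n) (X : Subset n) (u : Fin n) : Fin n → Set where
  here : u ∉ X → Reach G X u u
  there : ∀ {w v} → Reach G X u w → adj G w v ≡ true → v ∉ X → Reach G X u v

CutSet : ∀ {n} → Graph n → Subset n → Set
CutSet G X = ∃[ u ] ∃[ v ] (u ∉ X × v ∉ X × ¬ Reach G X u v)

-- A percolating set A₀ must meet every component of G − X when ∣X∣ < r:
-- a component without initially infected vertices only ever sees infected
-- neighbours inside X, so it never reaches the threshold. Hence if X is a small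
-- cut set, no vertex outside X is adjacent to all of A₀, for it would join all
-- components of G − X. With two disjoint small cut sets every vertex lies
-- outside one of them, so no vertex has r = ∣A₀∣ infected neighbours at time 0,
-- the infection never spreads, and A₀ would have to be all of V(G), though
-- ∣V(G)∣ > r.
module Submission where

open import Defs hiding (sym)
open import Data.Nat using (ℕ; suc; zero; _≤_; _<_)
open import Data.Nat.Properties using (≤ᵇ⇒≤; ≤-trans; <⇒≱)
open import Data.Bool using (Bool; true)
open import Data.Bool.Properties using (T-≡)
open import Data.Fin using (Fin)
open import Data.Fin.Subset using (Subset; _∈_; _∉_; ∣_∣; _∩_; _⊆_; _⊂_; ⊤)
open import Data.Fin.Subset.Properties
  using (_∈?_; x∈p∩q⁻; x∈p∩q⁺; x∈p∪q⁻; p∩q⊆q; p⊆q⇒∣p∣≤∣q∣; p⊂q⇒∣p∣<∣q∣; ∣⊤∣≡n)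
open import Data.Vec using (tabulate)
open import Data.Vec.Properties using ([]=⇒lookup; lookup∘tabulate)
open import Data.Product using (∃-syntax; _×_; _,_; proj₁)
open import Data.Sum using (_⊎_; inj₁; inj₂)
open import Data.Empty using (⊥-elim)
open import Function using (_∘_; Equivalence)
open import Relation.Binary.PropositionalEquality using (_≡_; sym; trans; subst)
open import Relation.Nullary using (¬_; yes; no)

module _ {n : ℕ} where

  ∈-tabulate⁻ : ∀ {f : Fin n → Bool} {x} → x ∈ tabulate f → f x ≡ true
  ∈-tabulate⁻ {f} {x} x∈ = trans (sym (lookup∘tabulate f x)) ([]=⇒lookup x∈)

  ∩-monoʳ-⊆ : ∀ {p q q′ : Subset n} → q ⊆ q′ → p ∩ q ⊆ p ∩ q′
  ∩-monoʳ-⊆ {p} {q} q⊆q′ x∈ with x∈p∩q⁻ p q x∈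
  ... | x∈p , x∈q = x∈p∩q⁺ (x∈p , q⊆q′ x∈q)

  ∣q∣≤∣p∩q∣⇒q⊆p : ∀ {p q : Subset n} → ∣ q ∣ ≤ ∣ p ∩ q ∣ → q ⊆ p
  ∣q∣≤∣p∩q∣⇒q⊆p {p} {q} ∣q∣≤ {x} x∈q with x ∈? p
  ... | yes x∈p = x∈p
  ... | no x∉p = ⊥-elim (<⇒≱ (p⊂q⇒∣p∣<∣q∣ p∩q⊂q) ∣q∣≤)
    where
      p∩q⊂q : p ∩ q ⊂ q
      p∩q⊂q = p∩q⊆q p q , x , x∈q , x∉p ∘ proj₁ ∘ x∈p∩q⁻ p q

module _ {n : ℕ} (G : Graph n) where

  Reach-end∉ : ∀ {X u v} → Reach G X u v → v ∉ X
  Reach-end∉ (here u∉X)       = u∉X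
  Reach-end∉ (there _ _ v∉X) = v∉X

  Reach-trans : ∀ {X u w v} → Reach G X u w → Reach G X w v → Reach G X u v
  Reach-trans p (here _)          = p
  Reach-trans p (there q w~v v∉X) = there (Reach-trans p q) w~v v∉X

  Reach-sym : ∀ {X u v} → Reach G X u v → Reach G X v u
  Reach-sym (here u∉X) = here u∉X
  Reach-sym (there {w} {v} p w~v v∉X) =
    Reach-trans (there (here v∉X) (trans (Graph.sym G v w) w~v) (Reach-end∉ p)) (Reach-sym p)

  ∈-step⁻ : ∀ {r A x} → x ∈ step r G A → x ∈ A ⊎ r ≤ ∣ N G x ∩ A ∣
  ∈-step⁻ {r} {A} {x} x∈ with x∈p∪q⁻ A _ x∈
  ... | inj₁ x∈A = inj₁ x∈A
  ... | inj₂ x∈new = inj₂ (≤ᵇ⇒≤ r _ (Equivalence.from T-≡ (∈-tabulate⁻ x∈new)))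

  Closed : ℕ → Subset n → Set
  Closed r A = ∀ v → r ≤ ∣ N G v ∩ A ∣ → v ∈ A

  infected-⊆-closed : ∀ {r A} → Closed r A → ∀ t → infected r G A t ⊆ A
  infected-⊆-closed closed zero    x∈ = x∈
  infected-⊆-closed closed (suc t) {x} x∈ with ∈-step⁻ x∈
  ... | inj₁ x∈Aₜ = infected-⊆-closed closed t x∈Aₜ
  ... | inj₂ r≤  = closed x (≤-trans r≤ (p⊆q⇒∣p∣≤∣q∣ (∩-monoʳ-⊆ {p = N G x} (infected-⊆-closed closed t))))

  closed-percolating⇒full : ∀ {r A} → Closed r A → Percolates r G A → n ≤ ∣ A ∣
  closed-percolating⇒full {A = A} closed (t , all-infected) =
    subst (_≤ ∣ A ∣) (∣⊤∣≡n n)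
      (p⊆q⇒∣p∣≤∣q∣ {p = ⊤} (λ {x} _ → infected-⊆-closed closed t (all-infected x)))

  Unseeded : Subset n → Subset n → Fin n → Set
  Unseeded X A u = ∀ w → w ∈ A → ¬ Reach G X u w

  unseeded-never-infected : ∀ {r A X u} → ∣ X ∣ < r → Unseeded X A u
    → ∀ t w → Reach G X u w → w ∉ infected r G A t
  unseeded-never-infected _ unseeded zero w u⇝w w∈A = unseeded w w∈A u⇝w
  unseeded-never-infected {r} {A} {X} ∣X∣<r unseeded (suc t) w u⇝w w∈ with ∈-step⁻ w∈
  ... | inj₁ w∈Aₜ = unseeded-never-infected ∣X∣<r unseeded t w u⇝w w∈Aₜ
  ... | inj₂ r≤  = <⇒≱ ∣X∣<r (≤-trans r≤ (p⊆q⇒∣p∣≤∣q∣ infected-neighbours⊆X))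
    where
      infected-neighbours⊆X : N G w ∩ infected r G A t ⊆ X
      infected-neighbours⊆X {z} z∈ with z ∈? X | x∈p∩q⁻ (N G w) _ z∈
      ... | yes z∈X | _           = z∈X
      ... | no z∉X  | w~z , z∈Aₜ =
        ⊥-elim (unseeded-never-infected ∣X∣<r unseeded t z (there u⇝w (∈-tabulate⁻ w~z) z∉X) z∈Aₜ)

  percolating⇒seeded : ∀ {r A X u} → Percolates r G A → ∣ X ∣ < r → u ∉ X → ¬ Unseeded X A u
  percolating⇒seeded (t , all-infected) ∣X∣<r u∉X unseeded =
    unseeded-never-infected ∣X∣<r unseeded t _ (here u∉X) (all-infected _)

  small-cut⇒no-dominating-vertex : ∀ {r A X} → Percolates r G A → CutSet G X → ∣ X ∣ < r
    → ∀ v → v ∉ X → ¬ (A ⊆ N G v)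
  small-cut⇒no-dominating-vertex {A = A} {X} perc (u₁ , u₂ , u₁∉X , u₂∉X , u₁↮u₂) ∣X∣<r v v∉X A⊆Nv =
    percolating⇒seeded perc ∣X∣<r u₁∉X λ w₁ w₁∈A u₁⇝w₁ →
    percolating⇒seeded perc ∣X∣<r u₂∉X λ w₂ w₂∈A u₂⇝w₂ →
    u₁↮u₂ (Reach-trans (via-v w₁∈A u₁⇝w₁) (Reach-sym (via-v w₂∈A u₂⇝w₂)))
    where
      via-v : ∀ {u w} → w ∈ A → Reach G X u w → Reach G X u v
      via-v {w = w} w∈A u⇝w = there u⇝w (trans (Graph.sym G w v) (∈-tabulate⁻ (A⊆Nv w∈A))) v∉X

mainTheorem6 : ∀ (r n : ℕ) (G : Graph n) → 1 ≤ r → BG r G → suc r ≤ n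
    → (A₀ : Subset n) → ∣ A₀ ∣ ≡ r → Percolates r G A₀
    → (X : Subset n) → CutSet G X → ∣ X ∣ < r
    → ¬ (∃[ Y ] (CutSet G Y × ∣ Y ∣ < r × (∀ v → v ∈ Y → v ∉ X)))
mainTheorem6 r n G _ _ r<n A₀ ∣A₀∣≡r perc X cutX ∣X∣<r (Y , cutY , ∣Y∣<r , Y∩X≡∅) =
  <⇒≱ r<n (subst (n ≤_) ∣A₀∣≡r (closed-percolating⇒full G A₀-closed perc))
  where
    dominating : ∀ v → r ≤ ∣ N G v ∩ A₀ ∣ → A₀ ⊆ N G v
    dominating v r≤ = ∣q∣≤∣p∩q∣⇒q⊆p (subst (_≤ ∣ N G v ∩ A₀ ∣) (sym ∣A₀∣≡r) r≤)

    A₀-closed : Closed G r A₀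
    A₀-closed v r≤ with v ∈? X
    ... | yes v∈X = ⊥-elim (small-cut⇒no-dominating-vertex G perc cutY ∣Y∣<r v
                              (λ v∈Y → Y∩X≡∅ v v∈Y v∈X) (dominating v r≤))
    ... | no v∉X  = ⊥-elim (small-cut⇒no-dominating-vertex G perc cutX ∣X∣<r v v∉X (dominating v r≤))
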